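{- Let $([n],\mathsf{d})$ be a metric space and $\alpha\ge 1$. For $\beta\ge1$ and $s,u\in[n]$ let $Z_\beta(s,u)=\{t\in[n]:\mathsf{d}(u,t)<\mathsf{d}(s,t)/\beta\}$. If $s,x,y,z\in[n]$ satisfy $z\in Z_{2\alpha}(s,x)$ and $\mathsf{d}(x,y)\le\mathsf{d}(x,z)$, then $z\in Z_\alpha(s,y)$. -}

module Defs where

open import Level using (0ℓ)
open import Data.Nat using (ℕ)
open import Data.Fin using (Fin)
open import Data.Sum using (_⊎_)
open import Relation.Nullary using (¬_)
open import Relation.Binary.PropositionalEquality using (_≡_)
open import Relation.Binary.Core using (Rel)
open import Relation.Binary.Structures using (IsStrictTotalOrder)
open import Algebra.Structures using (IsCommutativeRing)

-- The standard library has no real numbers.  We work over an arbitrary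
-- ordered field (ℝ is an instance); the usual axioms, with a total
-- inverse function (the value of 0⁻¹ is irrelevant).
record OrderedField : Set₁ where
  infixl 6 _+_
  infixl 7 _*_
  infix 4 _<_ _≤_
  field
    Carrier : Set
    _+_ _*_ : Carrier → Carrier → Carrier
    -_      : Carrier → Carrier
    0# 1#   : Carrier
    _⁻¹     : Carrier → Carrier
    _<_     : Rel Carrier 0ℓ
    isCommutativeRing  : IsCommutativeRing _≡_ _+_ _*_ -_ 0# 1#
    0≢1                : ¬ (0# ≡ 1#)
    ⁻¹-inverse         : ∀ x → ¬ (x ≡ 0#) → x * (x ⁻¹) ≡ 1#
    isStrictTotalOrder : IsStrictTotalOrder _≡_ _<_
    +-mono-<           : ∀ {x y} z → x < y → x + z < y + z
    *-pos              : ∀ {x y} → 0# < x → 0# < y → 0# < x * y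

  _≤_ : Rel Carrier 0ℓ
  x ≤ y = x < y ⊎ x ≡ y

  2# : Carrier
  2# = 1# + 1#

record Metric (F : OrderedField) (n : ℕ) : Set where
  open OrderedField F
  field
    d          : Fin n → Fin n → Carrier
    nonneg     : ∀ x y → 0# ≤ d x y
    zero⇒eq    : ∀ x y → d x y ≡ 0# → x ≡ y
    eq⇒zero    : ∀ x → d x x ≡ 0#
    sym        : ∀ x y → d x y ≡ d y x
    triangle   : ∀ x y z → d x z ≤ d x y + d y z

Z : (F : OrderedField) {n : ℕ} → Metric F n → OrderedField.Carrier F →
    Fin n → Fin n → Fin n → Set
Z F M β s u t = d u t < d s t * (β ⁻¹)
  where open OrderedField F
        open Metric M

-- The triangle inequality through x gives d(y,z) ≤ d(y,x) + d(x,z) ≤ 2 d(x,z),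
-- and 2 d(x,z) < 2 · d(s,z)/(2α) = d(s,z)/α.
module Submission where

open import Defs
open import Data.Nat using (ℕ)
open import Data.Fin using (Fin)
open import Data.Sum using (inj₁; inj₂)
open import Data.Empty using (⊥-elim)
open import Relation.Nullary using (¬_)
open import Relation.Binary.Definitions using (tri<; tri≈; tri>)
open import Relation.Binary.PropositionalEquality
  using (_≡_; refl; sym; trans; cong; cong₂; subst; subst₂; module ≡-Reasoning)
open import Relation.Binary.Structures using (IsStrictTotalOrder)
open import Algebra.Structures using (IsCommutativeRing)
open import Algebra.Bundles using (Ring)
import Algebra.Properties.Ring as RingProperties

module OrderedFieldProperties (F : OrderedField) where
  open OrderedField F
  open IsCommutativeRing isCommutativeRing
    using (+-comm; +-identityˡ; -‿inverseʳ; *-assoc; *-comm; *-identityˡ; *-identityʳ; distribˡ; isRing)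
  open IsStrictTotalOrder isStrictTotalOrder using (compare; irrefl) renaming (trans to <-trans)

  ring : Ring _ _
  ring = record { isRing = isRing }
  open RingProperties ring using (-1*x≈-x; -‿involutive)
  open ≡-Reasoning

  <-≤-trans : ∀ {a b c} → a < b → b ≤ c → a < c
  <-≤-trans p (inj₁ q)    = <-trans p q
  <-≤-trans p (inj₂ refl) = p

  ≤-<-trans : ∀ {a b c} → a ≤ b → b < c → a < c
  ≤-<-trans (inj₁ p)    q = <-trans p q
  ≤-<-trans (inj₂ refl) q = q

  ≤-trans : ∀ {a b c} → a ≤ b → b ≤ c → a ≤ c
  ≤-trans (inj₁ p)    q = inj₁ (<-≤-trans p q)
  ≤-trans (inj₂ refl) q = q

  +-monoˡ-≤ : ∀ {x y} z → x ≤ y → x + z ≤ y + z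
  +-monoˡ-≤ z (inj₁ p)    = inj₁ (+-mono-< z p)
  +-monoˡ-≤ z (inj₂ refl) = inj₂ refl

  +-monoʳ-< : ∀ {x y} z → x < y → z + x < z + y
  +-monoʳ-< {x} {y} z p = subst₂ _<_ (+-comm x z) (+-comm y z) (+-mono-< z p)

  +-mono-<-< : ∀ {x y u v} → x < y → u < v → x + u < y + v
  +-mono-<-< {y = y} {u} p q = <-trans (+-mono-< u p) (+-monoʳ-< y q)

  >0⇒≢0 : ∀ {x} → 0# < x → ¬ x ≡ 0#
  >0⇒≢0 p e = irrefl (sym e) p

  -- If 1 < 0 then 0 < -1, whose square (-1)(-1) = 1 is then positive too.
  0<1 : 0# < 1#
  0<1 with compare 0# 1#
  ... | tri< 0<1 _ _ = 0<1
  ... | tri≈ _ 0≡1 _ = ⊥-elim (0≢1 0≡1)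
  ... | tri> _ _ 1<0 = ⊥-elim (irrefl refl (<-trans 1<0 0<1′))
    where
    0<-1 : 0# < - 1#
    0<-1 = subst₂ _<_ (-‿inverseʳ 1#) (+-identityˡ (- 1#)) (+-mono-< (- 1#) 1<0)
    0<1′ : 0# < 1#
    0<1′ = subst (0# <_) (trans (-1*x≈-x (- 1#)) (-‿involutive 1#)) (*-pos 0<-1 0<-1)

  0<2 : 0# < 2#
  0<2 = <-trans 0<1 (subst (_< 2#) (+-identityˡ 1#) (+-mono-< 1# 0<1))

  x+x≡x*2 : ∀ x → x + x ≡ x * 2#
  x+x≡x*2 x = begin
    x + x             ≡⟨ cong₂ _+_ (sym (*-identityʳ x)) (sym (*-identityʳ x)) ⟩
    x * 1# + x * 1#   ≡⟨ sym (distribˡ x 1# 1#) ⟩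
    x * 2#            ∎

  [a*b]⁻¹*a≡b⁻¹ : ∀ {a b} → ¬ a * b ≡ 0# → ¬ b ≡ 0# → (a * b) ⁻¹ * a ≡ b ⁻¹
  [a*b]⁻¹*a≡b⁻¹ {a} {b} ab≢0 b≢0 = begin
    c * a                 ≡⟨ sym (*-identityʳ (c * a)) ⟩
    c * a * 1#            ≡⟨ cong (c * a *_) (sym (⁻¹-inverse b b≢0)) ⟩
    c * a * (b * b ⁻¹)    ≡⟨ sym (*-assoc (c * a) b (b ⁻¹)) ⟩
    c * a * b * b ⁻¹      ≡⟨ cong (_* b ⁻¹) (*-assoc c a b) ⟩
    c * (a * b) * b ⁻¹    ≡⟨ cong (_* b ⁻¹) (*-comm c (a * b)) ⟩
    (a * b) * c * b ⁻¹    ≡⟨ cong (_* b ⁻¹) (⁻¹-inverse (a * b) ab≢0) ⟩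
    1# * b ⁻¹             ≡⟨ *-identityˡ (b ⁻¹) ⟩
    b ⁻¹                  ∎
    where c = (a * b) ⁻¹

  double-<-halved : ∀ {α x y} → 0# < α → x < y * (2# * α) ⁻¹ → x + x < y * α ⁻¹
  double-<-halved {α} {x} {y} 0<α x<y/2α = subst (x + x <_) y/2α+y/2α≡y/α
    (+-mono-<-< x<y/2α x<y/2α)
    where
    y/2α+y/2α≡y/α : y * (2# * α) ⁻¹ + y * (2# * α) ⁻¹ ≡ y * α ⁻¹
    y/2α+y/2α≡y/α = begin
      y * (2# * α) ⁻¹ + y * (2# * α) ⁻¹   ≡⟨ x+x≡x*2 _ ⟩
      y * (2# * α) ⁻¹ * 2#                ≡⟨ *-assoc y _ 2# ⟩
      y * ((2# * α) ⁻¹ * 2#)              ≡⟨ cong (y *_) ([a*b]⁻¹*a≡b⁻¹ (>0⇒≢0 (*-pos 0<2 0<α)) (>0⇒≢0 0<α)) ⟩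
      y * α ⁻¹                            ∎

module MetricProperties {F : OrderedField} {n : ℕ} (M : Metric F n) where
  open OrderedField F
  open Metric M renaming (sym to d-sym)
  open OrderedFieldProperties F

  d-closer⇒d≤double : ∀ {x y z} → d x y ≤ d x z → d y z ≤ d x z + d x z
  d-closer⇒d≤double {x} {y} {z} dxy≤dxz =
    ≤-trans (triangle y x z) (+-monoˡ-≤ (d x z) (subst (_≤ d x z) (d-sym x y) dxy≤dxz))

claim5p14 : (F : OrderedField) → (n : ℕ) → (M : Metric F n) →
    (α : OrderedField.Carrier F) → OrderedField._≤_ F (OrderedField.1# F) α →
    (s x y z : Fin n) →
    Z F M (OrderedField._*_ F (OrderedField.2# F) α) s x z →
    OrderedField._≤_ F (Metric.d M x y) (Metric.d M x z) →
    Z F M α s y z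
claim5p14 F n M α 1≤α s x y z z∈Z₂α dxy≤dxz =
  ≤-<-trans (d-closer⇒d≤double dxy≤dxz) (double-<-halved 0<α z∈Z₂α)
  where
  open OrderedFieldProperties F
  open MetricProperties M
  0<α : OrderedField._<_ F (OrderedField.0# F) α
  0<α = <-≤-trans 0<1 1≤α
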